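{- Let $S$ and $T$ be association schemes on finite sets $X$ and $Y$, and $\phi$ an admissible morphism from $S$ to $T$. If $s\in S$ is thin, then $\phi(s)\in T$ is thin.
   Context: An association scheme on a finite set $X$ is a partition $S$ of $X\times X$ into nonempty subsets such that $1_X=\{(x,x)\}\in S$; $s^*=\{(x,y):(y,x)\in s\}\in S$; and for $p,q,r\in S$ there is $a_{pq}^r\ge0$ with $|\{y:(x,y)\in p,(y,z)\in q\}|=a_{pq}^r$ whenever $(x,z)\in r$. The valency $n_s=|\{y:(x,y)\in s\}|$ (independent of $x$); $s$ is thin if $n_s=1$. A morphism from a scheme $S$ on $X$ to a scheme $T$ on $Y$ is a function $\phi:X\cup S\to Y\cup T$ with $\phi(X)\subseteq Y$, $\phi(S)\subseteq T$, $(\phi(x_1),\phi(x_2))\in\phi(s)$ whenever $(x_1,x_2)\in s$; it is admissible if whenever $(\phi(x),y)\in\phi(s)$ there is $x'\in X$ with $\phi(x')=y$ and $(x,x')\in s$. -}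

module Defs where

open import Data.Nat using (ℕ)
open import Data.Fin using (Fin; _≟_)
open import Data.Fin.Properties using () renaming (_≟_ to _≟F_)
open import Data.List using (length; filter)
open import Data.List.Base using (allFin)
open import Data.Product using (Σ; ∃; ∃-syntax; _×_; _,_)
open import Relation.Binary.PropositionalEquality using (_≡_)
open import Relation.Nullary using (Dec; yes; no)
open import Relation.Nullary.Decidable using (_×-dec_)
open import Function.Bundles using (_⇔_)

count : (n : ℕ) {P : Fin n → Set} → ((y : Fin n) → Dec (P y)) → ℕ
count n P? = length (filter P? (allFin n))

-- The partition S of X × X is given by a class index set Fin k and the map
-- rel : X → X → Fin k sending (x , y) to the class containing it.
-- Every class is required to be nonempty, so distinct indices are distinct classes.
record AssocScheme (n : ℕ) : Set where
  field
    k        : ℕ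
    rel      : Fin n → Fin n → Fin k
    nonempty : (s : Fin k) → ∃[ x ] ∃[ y ] rel x y ≡ s
    one      : Fin k
    one-spec : (x y : Fin n) → (rel x y ≡ one) ⇔ (x ≡ y)
    star      : Fin k → Fin k
    star-spec : (x y : Fin n) → rel y x ≡ star (rel x y)
    intersection : (p q r : Fin k) → ∃[ a ] ((x z : Fin n) → rel x z ≡ r →
      count n (λ y → (rel x y ≟F p) ×-dec (rel y z ≟F q)) ≡ a)

  valencyAt : Fin n → Fin k → ℕ
  valencyAt x s = count n (λ y → rel x y ≟F s)

  -- s is thin: n_s = 1 (n_s is independent of x)
  Thin : Fin k → Set
  Thin s = (x : Fin n) → valencyAt x s ≡ 1

open AssocScheme public

record Morphism {n m : ℕ} (S : AssocScheme n) (T : AssocScheme m) : Set where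
  field
    onPt  : Fin n → Fin m
    onRel : Fin (k S) → Fin (k T)
    preserves : (x₁ x₂ : Fin n) → rel T (onPt x₁) (onPt x₂) ≡ onRel (rel S x₁ x₂)

open Morphism public

Admissible : {n m : ℕ} {S : AssocScheme n} {T : AssocScheme m} → Morphism S T → Set
Admissible {n} {m} {S} {T} φ =
  (x : Fin n) (s : Fin (k S)) (y : Fin m) →
  rel T (onPt φ x) y ≡ onRel φ s →
  ∃[ x' ] (onPt φ x' ≡ y × rel S x x' ≡ s)

module Submission where

-- The proof has three ingredients.
--  * Counting: for a decidable predicate P on Fin n, 'count n P? ≡ 1' holds
--    exactly when P has a unique witness.  This follows from a general fact
--    about filtering duplicate-free lists.
--  * Schemes: in an association scheme the number of y with (x , y) ∈ t does
--    not depend on x, since it equals the intersection number a_{t t*}^{1}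
--    evaluated at the pair (x , x).  Hence t is thin as soon as it has
--    valency 1 at a single point.
--  * Morphisms: if s has a unique successor x₁ of x₀, then φ(x₁) is a
--    successor of φ(x₀) along φ(s) by the morphism property, and by
--    admissibility every such successor is the image of an s-successor of
--    x₀, hence equals φ(x₁).  So φ(s) has valency 1 at φ(x₀).
-- Since s is nonempty some x₀ exists, and the theorem follows.

open import Defs
open import Data.Nat using (ℕ)
open import Data.Fin using (Fin)
open import Data.Fin.Properties using () renaming (_≟_ to _≟F_)
open import Data.List using (List; []; _∷_; length; filter; allFin)
open import Data.List.Properties using (filter-≐)
open import Data.List.Membership.Propositional using (_∈_)
open import Data.List.Membership.Propositional.Properties using (∈-filter⁺; ∈-filter⁻; ∈-allFin)
open import Data.List.Relation.Unary.Any using (here; there)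
open import Data.List.Relation.Unary.All using (_∷_)
open import Data.List.Relation.Unary.AllPairs using (_∷_)
open import Data.List.Relation.Unary.Unique.Propositional using (Unique)
open import Data.List.Relation.Unary.Unique.Propositional.Properties using (allFin⁺; filter⁺)
open import Data.Product using (∃-syntax; _×_; _,_; proj₁; proj₂)
open import Data.Empty using (⊥-elim)
open import Relation.Binary.PropositionalEquality using (_≡_; refl; sym; trans; cong; subst)
open import Relation.Nullary using (Dec)
open import Relation.Nullary.Decidable using (_×-dec_)
open import Relation.Unary using (Decidable; _≐_)
open import Function.Bundles using (Equivalence)

ExactlyOne : {A : Set} → (A → Set) → Set
ExactlyOne {A} P = ∃[ a ] (P a × ((b : A) → P b → b ≡ a))

unique-singleton : {A : Set} {ys : List A} {a : A} → Unique ys → a ∈ ys →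
  (∀ {b} → b ∈ ys → b ≡ a) → length ys ≡ 1
unique-singleton {ys = c ∷ []}        _                   _ _   = refl
unique-singleton {ys = c ∷ d ∷ _}     ((c≢d ∷ _) ∷ _)     _ all =
  ⊥-elim (c≢d (trans (all (here refl)) (sym (all (there (here refl))))))

module _ {A : Set} {P : A → Set} (P? : Decidable P) where

  filter-length≡1⇒unique : (xs : List A) → length (filter P? xs) ≡ 1 →
    ∃[ a ] (P a × (∀ {b} → b ∈ xs → P b → b ≡ a))
  filter-length≡1⇒unique xs len with filter P? xs in filtered
  ... | a ∷ [] = a , proj₂ (∈-filter⁻ P? {xs = xs} a∈filter) , only
    where
    a∈filter : a ∈ filter P? xs
    a∈filter = subst (a ∈_) (sym filtered) (here refl)

    only : ∀ {b} → b ∈ xs → P b → b ≡ a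
    only b∈xs pb with subst (_ ∈_) filtered (∈-filter⁺ P? b∈xs pb)
    ... | here b≡a = b≡a

  unique⇒filter-length≡1 : {xs : List A} {a : A} → Unique xs → a ∈ xs → P a →
    (∀ {b} → b ∈ xs → P b → b ≡ a) → length (filter P? xs) ≡ 1
  unique⇒filter-length≡1 uniq a∈xs pa only =
    unique-singleton (filter⁺ P? uniq) (∈-filter⁺ P? a∈xs pa)
      (λ b∈filter → let (b∈xs , pb) = ∈-filter⁻ P? b∈filter in only b∈xs pb)

module _ {n : ℕ} {P : Fin n → Set} (P? : (y : Fin n) → Dec (P y)) where

  count≡1⇒exactlyOne : count n P? ≡ 1 → ExactlyOne P
  count≡1⇒exactlyOne c≡1 with filter-length≡1⇒unique P? (allFin n) c≡1
  ... | a , pa , only = a , pa , λ b pb → only (∈-allFin b) pb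

  exactlyOne⇒count≡1 : ExactlyOne P → count n P? ≡ 1
  exactlyOne⇒count≡1 (a , pa , only) =
    unique⇒filter-length≡1 P? (allFin⁺ n) (∈-allFin a) pa (λ {b} _ pb → only b pb)

count-cong : {n : ℕ} {P Q : Fin n → Set}
  (P? : (y : Fin n) → Dec (P y)) (Q? : (y : Fin n) → Dec (Q y)) →
  P ≐ Q → count n P? ≡ count n Q?
count-cong {n} P? Q? P≐Q = cong length (filter-≐ P? Q? P≐Q (allFin n))

module _ {n : ℕ} (S : AssocScheme n) where

  -- The valency of t at x is the intersection number a_{t t*}^{1}: since
  -- (y , x) ∈ t* follows from (x , y) ∈ t, both count the same points y.
  valency≡intersection : (x : Fin n) (t : Fin (k S)) →
    valencyAt S x t ≡ proj₁ (intersection S t (star S t) (one S))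
  valency≡intersection x t =
    trans (count-cong (λ y → rel S x y ≟F t) both? equivalent)
          (proj₂ (intersection S t (star S t) (one S)) x x x∼x)
    where
    both? : (y : Fin n) → Dec ((rel S x y ≡ t) × (rel S y x ≡ star S t))
    both? y = (rel S x y ≟F t) ×-dec (rel S y x ≟F star S t)
    x∼x : rel S x x ≡ one S
    x∼x = Equivalence.from (one-spec S x x) refl
    equivalent : (λ y → rel S x y ≡ t) ≐ (λ y → (rel S x y ≡ t) × (rel S y x ≡ star S t))
    equivalent = (λ {y} xy≡t → xy≡t , trans (star-spec S x y) (cong (star S) xy≡t)) , proj₁

  thin-from-point : (x : Fin n) (t : Fin (k S)) → valencyAt S x t ≡ 1 → Thin S t
  thin-from-point x t v≡1 y =
    trans (valency≡intersection y t) (trans (sym (valency≡intersection x t)) v≡1)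

-- Under an admissible morphism, a unique s-successor x₁ of x₀ yields a
-- unique φ(s)-successor φ(x₁) of φ(x₀): every φ(s)-successor lifts along s.
admissible-image-exactlyOne : {n m : ℕ} {S : AssocScheme n} {T : AssocScheme m}
  (φ : Morphism S T) → Admissible φ → (x₀ : Fin n) (s : Fin (k S)) →
  ExactlyOne (λ x → rel S x₀ x ≡ s) →
  ExactlyOne (λ z → rel T (onPt φ x₀) z ≡ onRel φ s)
admissible-image-exactlyOne {m = m} {T = T} φ adm x₀ s (x₁ , x₀∼x₁ , only-x₁) =
  onPt φ x₁ , image-related , only-image
  where
  image-related : rel T (onPt φ x₀) (onPt φ x₁) ≡ onRel φ s
  image-related = trans (preserves φ x₀ x₁) (cong (onRel φ) x₀∼x₁)

  only-image : (z : Fin m) → rel T (onPt φ x₀) z ≡ onRel φ s → z ≡ onPt φ x₁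
  only-image z related with adm x₀ s z related
  ... | x' , φx'≡z , x₀∼x' = trans (sym φx'≡z) (cong (onPt φ) (only-x₁ x' x₀∼x'))

admissible-preserves-valency-one : {n m : ℕ} {S : AssocScheme n} {T : AssocScheme m}
  (φ : Morphism S T) → Admissible φ → (x₀ : Fin n) (s : Fin (k S)) →
  valencyAt S x₀ s ≡ 1 → valencyAt T (onPt φ x₀) (onRel φ s) ≡ 1
admissible-preserves-valency-one {S = S} {T} φ adm x₀ s v≡1 =
  exactlyOne⇒count≡1 (λ z → rel T (onPt φ x₀) z ≟F onRel φ s)
    (admissible-image-exactlyOne φ adm x₀ s
      (count≡1⇒exactlyOne (λ x → rel S x₀ x ≟F s) v≡1))

corollary3p13 : {n m : ℕ} (S : AssocScheme n) (T : AssocScheme m)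
    (φ : Morphism S T) → Admissible φ →
    (s : Fin (k S)) → Thin S s → Thin T (onRel φ s)
corollary3p13 {n} S T φ adm s thin =
  thin-from-point T (onPt φ x₀) (onRel φ s)
    (admissible-preserves-valency-one φ adm x₀ s (thin x₀))
  where
  x₀ : Fin n
  x₀ = proj₁ (nonempty S s)
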